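{- If a strongly regular graph $\Gamma$ is triply transitive, then $\mathrm{Aut}(\Gamma)$ is transitive of rank $3$ on the vertex set, i.e. $\Gamma$ is a rank $3$ graph.
   Context: For a strongly regular graph $\Gamma=(\Omega,E)$: $A_0=I$, $A_1$ its adjacency matrix, $A_2=J-I-A_1$; for a vertex $\omega$, $E^*_{i,\omega}$ ($i=0,1,2$) is the diagonal matrix whose diagonal is the $\omega$-row of $A_i$; $T_\omega$ is the algebra generated by $A_0,A_1,A_2,E^*_{0,\omega},E^*_{1,\omega},E^*_{2,\omega}$; $T_{0,\omega}$ is the span of all $E^*_{i,\omega}A_jE^*_{k,\omega}$; $\tilde T_\omega$ is the algebra of complex matrices commuting with the permutation matrices of the stabilizer $G_\omega$ in $G=\mathrm{Aut}(\Gamma)$. $\Gamma$ is triply transitive if $G$ is transitive on $\Omega$ and $T_{0,\omega}=T_\omega=\tilde T_\omega$ for some (equivalently every) vertex $\omega$. A rank $3$ graph is one whose automorphism group is transitive with point stabilizers having exactly $3$ orbits. -}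

module Defs where

open import Data.Nat as ℕ using (ℕ; zero; suc; _∸_)
open import Data.Bool using (Bool; true; false; if_then_else_)
open import Data.Fin using (Fin; zero; suc; _≟_)
open import Data.Fin.Permutation using (Permutation′; _⟨$⟩ʳ_)
open import Data.Rational using (ℚ; 0ℚ; 1ℚ; _+_; _*_; _-_)
open import Data.Product using (Σ; ∃; ∃-syntax; _×_; _,_)
open import Data.Sum using (_⊎_)
open import Relation.Nullary using (¬_; yes; no)
open import Relation.Binary.PropositionalEquality using (_≡_; _≢_)
open import Function.Bundles using (_⇔_)
open import Level using (0ℓ)

Graph : ℕ → Set
Graph n = Fin n → Fin n → Bool

count : ∀ {n} → (Fin n → Bool) → ℕ
count {zero}  f = 0
count {suc n} f = (if f zero then 1 else 0) ℕ.+ count (λ i → f (suc i))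

_∧ᵇ_ : Bool → Bool → Bool
true ∧ᵇ b = b
false ∧ᵇ b = false

degree : ∀ {n} → Graph n → Fin n → ℕ
degree adj x = count (adj x)

commonNbrs : ∀ {n} → Graph n → Fin n → Fin n → ℕ
commonNbrs adj x y = count (λ z → adj x z ∧ᵇ adj y z)

-- Strongly regular with parameters (v = n, k, λ, μ); as usual the
-- complete and edgeless graphs are excluded: 0 < k < v - 1.
record IsSRG {n : ℕ} (adj : Graph n) (k lam mu : ℕ) : Set where
  field
    symmetric   : ∀ x y → adj x y ≡ adj y x
    irreflexive : ∀ x → adj x x ≡ false
    regular     : ∀ x → degree adj x ≡ k
    adjacent    : ∀ x y → x ≢ y → adj x y ≡ true  → commonNbrs adj x y ≡ lam
    nonadjacent : ∀ x y → x ≢ y → adj x y ≡ false → commonNbrs adj x y ≡ mu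
    nonEmpty    : 0 ℕ.< k
    nonComplete : k ℕ.< n ∸ 1

StronglyRegular : ∀ {n} → Graph n → Set
StronglyRegular adj = ∃[ k ] ∃[ lam ] ∃[ mu ] IsSRG adj k lam mu

IsAut : ∀ {n} → Graph n → Permutation′ n → Set
IsAut adj σ = ∀ x y → adj (σ ⟨$⟩ʳ x) (σ ⟨$⟩ʳ y) ≡ adj x y

InStab : ∀ {n} → Graph n → Fin n → Permutation′ n → Set
InStab adj ω σ = IsAut adj σ × (σ ⟨$⟩ʳ ω ≡ ω)

AutTransitive : ∀ {n} → Graph n → Set
AutTransitive adj = ∀ x y → ∃[ σ ] (IsAut adj σ × (σ ⟨$⟩ʳ x ≡ y))

SameStabOrbit : ∀ {n} → Graph n → Fin n → Fin n → Fin n → Set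
SameStabOrbit adj ω x y = ∃[ σ ] (InStab adj ω σ × (σ ⟨$⟩ʳ x ≡ y))

ExactlyThreeStabOrbits : ∀ {n} → Graph n → Fin n → Set
ExactlyThreeStabOrbits adj ω =
  ∃[ a ] ∃[ b ] ∃[ c ]
    ( ¬ SameStabOrbit adj ω a b
    × ¬ SameStabOrbit adj ω a c
    × ¬ SameStabOrbit adj ω b c
    × (∀ x → SameStabOrbit adj ω a x ⊎ SameStabOrbit adj ω b x ⊎ SameStabOrbit adj ω c x))

Rank3Graph : ∀ {n} → Graph n → Set
Rank3Graph adj = AutTransitive adj × (∀ ω → ExactlyThreeStabOrbits adj ω)

Mat : ℕ → Set
Mat n = Fin n → Fin n → ℚ

_≈ₘ_ : ∀ {n} → Mat n → Mat n → Set
M ≈ₘ N = ∀ i j → M i j ≡ N i j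

sumF : ∀ {n} → (Fin n → ℚ) → ℚ
sumF {zero}  f = 0ℚ
sumF {suc n} f = f zero + sumF (λ i → f (suc i))

_+ₘ_ : ∀ {n} → Mat n → Mat n → Mat n
(M +ₘ N) i j = M i j + N i j

_·ₘ_ : ∀ {n} → ℚ → Mat n → Mat n
(c ·ₘ M) i j = c * M i j

_*ₘ_ : ∀ {n} → Mat n → Mat n → Mat n
(M *ₘ N) i j = sumF (λ l → M i l * N l j)

0ₘ : ∀ {n} → Mat n
0ₘ i j = 0ℚ

δ : ∀ {n} → Fin n → Fin n → ℚ
δ i j with i ≟ j
... | yes _ = 1ℚ
... | no  _ = 0ℚ

Iₘ : ∀ {n} → Mat n
Iₘ = δ

Jₘ : ∀ {n} → Mat n
Jₘ i j = 1ℚ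

b2q : Bool → ℚ
b2q true  = 1ℚ
b2q false = 0ℚ

A : ∀ {n} → Graph n → Fin 3 → Mat n
A adj zero             = Iₘ
A adj (suc zero)       i j = b2q (adj i j)
A adj (suc (suc zero)) i j = (Jₘ i j - Iₘ i j) - b2q (adj i j)

Estar : ∀ {n} → Graph n → Fin 3 → Fin n → Mat n
Estar adj r ω i j = δ i j * A adj r ω i

data Span {n} (S : Mat n → Set) : Mat n → Set where
  gen  : ∀ {M} → S M → Span S M
  zer  : Span S 0ₘ
  add  : ∀ {M N} → Span S M → Span S N → Span S (M +ₘ N)
  scl  : ∀ {M} c → Span S M → Span S (c ·ₘ M)
  resp : ∀ {M N} → M ≈ₘ N → Span S M → Span S N

data Alg {n} (S : Mat n → Set) : Mat n → Set where
  gen  : ∀ {M} → S M → Alg S M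
  one  : Alg S Iₘ
  zer  : Alg S 0ₘ
  add  : ∀ {M N} → Alg S M → Alg S N → Alg S (M +ₘ N)
  scl  : ∀ {M} c → Alg S M → Alg S (c ·ₘ M)
  mul  : ∀ {M N} → Alg S M → Alg S N → Alg S (M *ₘ N)
  resp : ∀ {M N} → M ≈ₘ N → Alg S M → Alg S N

TGens : ∀ {n} → Graph n → Fin n → Mat n → Set
TGens adj ω M = (∃[ j ] M ≡ A adj j) ⊎ (∃[ i ] M ≡ Estar adj i ω)

T : ∀ {n} → Graph n → Fin n → Mat n → Set
T adj ω = Alg (TGens adj ω)

T0Gens : ∀ {n} → Graph n → Fin n → Mat n → Set
T0Gens adj ω M = ∃[ i ] ∃[ j ] ∃[ k ]
  (M ≡ (Estar adj i ω *ₘ A adj j) *ₘ Estar adj k ω)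

T0 : ∀ {n} → Graph n → Fin n → Mat n → Set
T0 adj ω = Span (T0Gens adj ω)

PermMat : ∀ {n} → Permutation′ n → Mat n
PermMat σ i j = δ (σ ⟨$⟩ʳ i) j

Ttilde : ∀ {n} → Graph n → Fin n → Mat n → Set
Ttilde adj ω M = ∀ σ → InStab adj ω σ → (PermMat σ *ₘ M) ≈ₘ (M *ₘ PermMat σ)

SameSet : ∀ {n} → (Mat n → Set) → (Mat n → Set) → Set
SameSet P Q = ∀ M → P M ⇔ Q M

TriplyTransitive : ∀ {n} → Graph n → Set
TriplyTransitive adj =
  AutTransitive adj ×
  ∃[ ω ] (SameSet (T0 adj ω) (T adj ω) × SameSet (T adj ω) (Ttilde adj ω))

{-# OPTIONS --safe #-}
-- Fix ω and b. The diagonal matrix whose diagonal is the indicator of the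
-- G_ω-orbit of b commutes with the permutation matrices of G_ω, so it lies in
-- T̃_ω = T_ω = T_{0,ω}. The diagonal entry of E*_{i,ω} A_j E*_{k,ω} at x is
-- A_i(ω,x) A_j(x,x) A_k(ω,x), and A_j(x,x) does not depend on x; hence every
-- matrix of T_{0,ω} has constant diagonal on each subconstituent {ω}, Γ(ω) and
-- Ω ∖ ({ω} ∪ Γ(ω)). Applied to the indicator, this puts the whole subconstituent
-- of b into the orbit of b, so the subconstituents are the G_ω-orbits. All three are
-- nonempty because Γ is neither empty nor complete, and transitivity of Aut(Γ)
-- carries the three orbits from ω to every vertex. Orbit membership is decided
-- by exhaustive search over the permutations of Ω; this is what makes the
-- indicator matrix definable.

module Submission where

open import Defs
open import Data.Nat using (ℕ; zero; suc; _∸_; _<_; _≤_; s≤s)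
import Data.Nat.Properties as ℕₚ
open import Data.Bool using (Bool; true; false)
import Data.Bool.Properties as Boolₚ
open import Data.Fin using (Fin; zero; suc; _≟_; punchIn; punchOut)
import Data.Fin.Properties as Finₚ
open import Data.Fin.Permutation
  using (Permutation; Permutation′; _⟨$⟩ʳ_; _⟨$⟩ˡ_; inverseˡ; inverseʳ; _≈_; id; flip; _∘ₚ_; insert; remove; insert-remove)
open import Data.Rational using (ℚ; 0ℚ; 1ℚ; _+_; _*_; _-_)
import Data.Rational.Properties as ℚₚ
open import Data.Product using (∃; ∃-syntax; _×_; _,_)
import Data.Sum as Sum
open import Data.Sum using (_⊎_; inj₁; inj₂)
open import Function using (_∘_)
open import Function.Bundles using (Equivalence; mk⇔)
open import Relation.Nullary using (Dec; yes; no; does; ¬_; ¬?; contradiction)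
open import Relation.Nullary.Decidable using (map′; _×-dec_; dec-true; does-⇔)
open import Relation.Unary using (Pred; Decidable)
open import Relation.Binary.Definitions using (_Respects_)
open import Relation.Binary.PropositionalEquality
open ≡-Reasoning

δ-refl : ∀ {n} (i : Fin n) → δ i i ≡ 1ℚ
δ-refl i with i ≟ i
... | yes _   = refl
... | no  i≢i = contradiction refl i≢i

δ-≢ : ∀ {n} {i j : Fin n} → i ≢ j → δ i j ≡ 0ℚ
δ-≢ {i = i} {j} i≢j with i ≟ j
... | yes i≡j = contradiction i≡j i≢j
... | no  _   = refl

sumF-zero : ∀ {n} (f : Fin n → ℚ) → (∀ i → f i ≡ 0ℚ) → sumF f ≡ 0ℚ
sumF-zero {zero}  f f≡0 = refl
sumF-zero {suc n} f f≡0 = begin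
  f zero + sumF (f ∘ suc) ≡⟨ cong₂ _+_ (f≡0 zero) (sumF-zero (f ∘ suc) (f≡0 ∘ suc)) ⟩
  0ℚ + 0ℚ                 ≡⟨ ℚₚ.+-identityˡ 0ℚ ⟩
  0ℚ                      ∎

sumF-single : ∀ {n} (f : Fin n → ℚ) (a : Fin n) → (∀ i → i ≢ a → f i ≡ 0ℚ) → sumF f ≡ f a
sumF-single {suc n} f zero f≡0 = begin
  f zero + sumF (f ∘ suc) ≡⟨ cong (f zero +_) (sumF-zero (f ∘ suc) (λ i → f≡0 (suc i) λ ())) ⟩
  f zero + 0ℚ             ≡⟨ ℚₚ.+-identityʳ (f zero) ⟩
  f zero                  ∎
sumF-single {suc n} f (suc a) f≡0 = begin
  f zero + sumF (f ∘ suc) ≡⟨ cong₂ _+_ (f≡0 zero λ ()) (sumF-single (f ∘ suc) a λ i i≢a → f≡0 (suc i) (i≢a ∘ Finₚ.suc-injective)) ⟩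
  0ℚ + f (suc a)          ≡⟨ ℚₚ.+-identityˡ (f (suc a)) ⟩
  f (suc a)               ∎

diag : ∀ {n} → (Fin n → ℚ) → Mat n
diag d i j = δ i j * d i

diag-diagonal : ∀ {n} (d : Fin n → ℚ) (i : Fin n) → diag d i i ≡ d i
diag-diagonal d i = trans (cong (_* d i) (δ-refl i)) (ℚₚ.*-identityˡ (d i))

diag-*ₘ : ∀ {n} (d : Fin n → ℚ) (M : Mat n) (i j : Fin n) → (diag d *ₘ M) i j ≡ d i * M i j
diag-*ₘ d M i j = begin
  sumF (λ l → diag d i l * M l j) ≡⟨ sumF-single _ i vanish ⟩
  diag d i i * M i j              ≡⟨ cong (_* M i j) (diag-diagonal d i) ⟩
  d i * M i j                     ∎
  where
  vanish : ∀ l → l ≢ i → diag d i l * M l j ≡ 0ℚ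
  vanish l l≢i = begin
    (δ i l * d i) * M l j ≡⟨ cong (λ e → (e * d i) * M l j) (δ-≢ (l≢i ∘ sym)) ⟩
    (0ℚ * d i) * M l j    ≡⟨ cong (_* M l j) (ℚₚ.*-zeroˡ (d i)) ⟩
    0ℚ * M l j            ≡⟨ ℚₚ.*-zeroˡ (M l j) ⟩
    0ℚ                    ∎

*ₘ-diag : ∀ {n} (M : Mat n) (d : Fin n → ℚ) (i j : Fin n) → (M *ₘ diag d) i j ≡ M i j * d j
*ₘ-diag M d i j = begin
  sumF (λ l → M i l * diag d l j) ≡⟨ sumF-single _ j vanish ⟩
  M i j * diag d j j              ≡⟨ cong (M i j *_) (diag-diagonal d j) ⟩
  M i j * d j                     ∎
  where
  vanish : ∀ l → l ≢ j → M i l * diag d l j ≡ 0ℚ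
  vanish l l≢j = begin
    M i l * (δ l j * d l) ≡⟨ cong (λ e → M i l * (e * d l)) (δ-≢ l≢j) ⟩
    M i l * (0ℚ * d l)    ≡⟨ cong (M i l *_) (ℚₚ.*-zeroˡ (d l)) ⟩
    M i l * 0ℚ            ≡⟨ ℚₚ.*-zeroʳ (M i l) ⟩
    0ℚ                    ∎

PermMat-*ₘ : ∀ {n} (σ : Permutation′ n) (M : Mat n) (i j : Fin n) → (PermMat σ *ₘ M) i j ≡ M (σ ⟨$⟩ʳ i) j
PermMat-*ₘ σ M i j = begin
  sumF (λ l → δ (σ ⟨$⟩ʳ i) l * M l j)      ≡⟨ sumF-single _ (σ ⟨$⟩ʳ i) vanish ⟩
  δ (σ ⟨$⟩ʳ i) (σ ⟨$⟩ʳ i) * M (σ ⟨$⟩ʳ i) j ≡⟨ cong (_* M (σ ⟨$⟩ʳ i) j) (δ-refl (σ ⟨$⟩ʳ i)) ⟩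
  1ℚ * M (σ ⟨$⟩ʳ i) j                      ≡⟨ ℚₚ.*-identityˡ (M (σ ⟨$⟩ʳ i) j) ⟩
  M (σ ⟨$⟩ʳ i) j                           ∎
  where
  vanish : ∀ l → l ≢ σ ⟨$⟩ʳ i → δ (σ ⟨$⟩ʳ i) l * M l j ≡ 0ℚ
  vanish l l≢σi = trans (cong (_* M l j) (δ-≢ (l≢σi ∘ sym))) (ℚₚ.*-zeroˡ (M l j))

diag-commutes-PermMat : ∀ {n} (σ : Permutation′ n) (d : Fin n → ℚ) →
                        (∀ i → d (σ ⟨$⟩ʳ i) ≡ d i) → (PermMat σ *ₘ diag d) ≈ₘ (diag d *ₘ PermMat σ)
diag-commutes-PermMat σ d d-invariant i j = begin
  (PermMat σ *ₘ diag d) i j     ≡⟨ PermMat-*ₘ σ (diag d) i j ⟩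
  δ (σ ⟨$⟩ʳ i) j * d (σ ⟨$⟩ʳ i) ≡⟨ cong (δ (σ ⟨$⟩ʳ i) j *_) (d-invariant i) ⟩
  δ (σ ⟨$⟩ʳ i) j * d i          ≡⟨ ℚₚ.*-comm (δ (σ ⟨$⟩ʳ i) j) (d i) ⟩
  d i * PermMat σ i j           ≡⟨ diag-*ₘ d (PermMat σ) i j ⟨
  (diag d *ₘ PermMat σ) i j     ∎

insert-cong : ∀ {m n} (i : Fin (suc m)) (j : Fin (suc n)) {π ρ : Permutation m n} →
              π ≈ ρ → insert i j π ≈ insert i j ρ
insert-cong i j π≈ρ k with i ≟ k
... | yes _   = refl
... | no  i≢k = cong (punchIn j) (π≈ρ (punchOut i≢k))

-- Exhaustive because every permutation π of Fin (suc n) is ≈ insert zero (π zero) (remove zero π).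
any-permutation? : ∀ {n p} {P : Pred (Permutation′ n) p} →
                   P Respects _≈_ → Decidable P → Dec (∃ P)
any-permutation? {zero} respects P? with P? id
... | yes p = yes (id , p)
... | no ¬p = no λ (π , pπ) → ¬p (respects (λ ()) pπ)
any-permutation? {suc n} {P = P} respects P? =
  map′ (λ (j , π , p) → insert zero j π , p)
       (λ (π , p) → π ⟨$⟩ʳ zero , remove zero π , respects (sym ∘ insert-remove zero π) p)
       (Finₚ.any? λ j → any-permutation? (respects ∘ insert-cong zero j) (P? ∘ insert zero j))

count-all : ∀ {n} (f : Fin n → Bool) → (∀ x → f x ≡ true) → count f ≡ n
count-all {zero}  f all = refl
count-all {suc n} f all rewrite all zero = cong suc (count-all (f ∘ suc) (all ∘ suc))

count>0⇒∃ : ∀ {n} (f : Fin n → Bool) → 0 < count f → ∃[ x ] f x ≡ true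
count>0⇒∃ {suc n} f pos with f zero in f0
... | true  = zero , f0
... | false with count>0⇒∃ (f ∘ suc) pos
...   | x , fx = suc x , fx

∸1≤count : ∀ {n} (f : Fin n → Bool) (ω : Fin n) → (∀ x → x ≢ ω → f x ≡ true) → n ∸ 1 ≤ count f
∸1≤count {suc n} f zero all =
  subst (_≤ count f) (count-all (f ∘ suc) (λ x → all (suc x) λ ())) (ℕₚ.m≤n+m (count (f ∘ suc)) _)
∸1≤count {suc n} f (suc ω) all rewrite all zero (λ ()) =
  ℕₚ.≤-trans (ℕₚ.m≤n+m∸n n 1)
             (s≤s (∸1≤count (f ∘ suc) ω λ x x≢ω → all (suc x) (x≢ω ∘ Finₚ.suc-injective)))

b2q-does≡1 : ∀ {p} {P : Set p} (p? : Dec P) → b2q (does p?) ≡ 1ℚ → P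
b2q-does≡1 (yes p) _ = p
b2q-does≡1 (no _) ()

module _ {n : ℕ} (adj : Graph n) where

  IsAut-∘ : ∀ {π ρ} → IsAut adj π → IsAut adj ρ → IsAut adj (π ∘ₚ ρ)
  IsAut-∘ π-aut ρ-aut x y = trans (ρ-aut _ _) (π-aut x y)

  IsAut-flip : ∀ {π} → IsAut adj π → IsAut adj (flip π)
  IsAut-flip {π} π-aut x y = trans (sym (π-aut _ _)) (cong₂ adj (inverseʳ π) (inverseʳ π))

  IsAut? : (σ : Permutation′ n) → Dec (IsAut adj σ)
  IsAut? σ = Finₚ.all? λ x → Finₚ.all? λ y → adj (σ ⟨$⟩ʳ x) (σ ⟨$⟩ʳ y) Boolₚ.≟ adj x y

  InStab-∘ : ∀ {ω π ρ} → InStab adj ω π → InStab adj ω ρ → InStab adj ω (π ∘ₚ ρ)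
  InStab-∘ {π = π} {ρ} (π-aut , π-fix) (ρ-aut , ρ-fix) =
    IsAut-∘ {π} {ρ} π-aut ρ-aut , trans (cong (ρ ⟨$⟩ʳ_) π-fix) ρ-fix

  InStab-flip : ∀ {ω π} → InStab adj ω π → InStab adj ω (flip π)
  InStab-flip {π = π} (π-aut , π-fix) =
    IsAut-flip {π} π-aut , trans (cong (π ⟨$⟩ˡ_) (sym π-fix)) (inverseˡ π)

  sameStabOrbit-refl : ∀ {ω x} → SameStabOrbit adj ω x x
  sameStabOrbit-refl = id , ((λ _ _ → refl) , refl) , refl

  sameStabOrbit-sym : ∀ {ω x y} → SameStabOrbit adj ω x y → SameStabOrbit adj ω y x
  sameStabOrbit-sym (σ , σ∈G , refl) = flip σ , InStab-flip {π = σ} σ∈G , inverseˡ σ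

  sameStabOrbit-trans : ∀ {ω x y z} → SameStabOrbit adj ω x y → SameStabOrbit adj ω y z → SameStabOrbit adj ω x z
  sameStabOrbit-trans (σ , σ∈G , refl) (ρ , ρ∈G , refl) = σ ∘ₚ ρ , InStab-∘ {π = σ} {ρ} σ∈G ρ∈G , refl

  sameStabOrbit-transport : ∀ {τ ω x y ω′ x′ y′} → IsAut adj τ →
                            τ ⟨$⟩ʳ ω ≡ ω′ → τ ⟨$⟩ʳ x ≡ x′ → τ ⟨$⟩ʳ y ≡ y′ →
                            SameStabOrbit adj ω x y → SameStabOrbit adj ω′ x′ y′
  sameStabOrbit-transport {τ} τ-aut refl refl refl (σ , (σ-aut , σ-fix) , refl) =
    flip τ ∘ₚ σ ∘ₚ τ ,
    (aut , cong (τ ⟨$⟩ʳ_) (trans (cong (σ ⟨$⟩ʳ_) (inverseˡ τ)) σ-fix)) ,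
    cong (λ z → τ ⟨$⟩ʳ (σ ⟨$⟩ʳ z)) (inverseˡ τ)
    where
    aut : IsAut adj (flip τ ∘ₚ σ ∘ₚ τ)
    aut = IsAut-∘ {flip τ} {σ ∘ₚ τ} (IsAut-flip {τ} τ-aut) (IsAut-∘ {σ} {τ} σ-aut τ-aut)

  sameStabOrbit? : ∀ ω x y → Dec (SameStabOrbit adj ω x y)
  sameStabOrbit? ω x y = any-permutation?
    (λ σ≈ρ ((σ-aut , σ-fix) , σx≡y) →
       ((λ u v → trans (cong₂ adj (sym (σ≈ρ u)) (sym (σ≈ρ v))) (σ-aut u v)) , trans (sym (σ≈ρ ω)) σ-fix) ,
       trans (sym (σ≈ρ x)) σx≡y)
    (λ σ → (IsAut? σ ×-dec (σ ⟨$⟩ʳ ω ≟ ω)) ×-dec (σ ⟨$⟩ʳ x ≟ y))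

  orbitIndicator : Fin n → Fin n → Fin n → ℚ
  orbitIndicator ω b x = b2q (does (sameStabOrbit? ω b x))

  orbitIndicator-invariant : ∀ {ω σ} b → InStab adj ω σ →
                             ∀ x → orbitIndicator ω b (σ ⟨$⟩ʳ x) ≡ orbitIndicator ω b x
  orbitIndicator-invariant {ω} {σ} b σ∈G x =
    cong b2q (does-⇔ (mk⇔ (λ s → sameStabOrbit-trans s (sameStabOrbit-sym x↦σx))
                          (λ s → sameStabOrbit-trans s x↦σx))
                     (sameStabOrbit? ω b (σ ⟨$⟩ʳ x)) (sameStabOrbit? ω b x))
    where
    x↦σx : SameStabOrbit adj ω x (σ ⟨$⟩ʳ x)
    x↦σx = σ , σ∈G , refl

  diag-orbitIndicator∈Ttilde : ∀ ω b → Ttilde adj ω (diag (orbitIndicator ω b))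
  diag-orbitIndicator∈Ttilde ω b σ σ∈G = diag-commutes-PermMat σ _ (orbitIndicator-invariant {σ = σ} b σ∈G)

  SameSubconstituent : Fin n → Fin n → Fin n → Set
  SameSubconstituent ω x y = ∀ r → A adj r ω x ≡ A adj r ω y

  sameSubconstituent-off-ω : ∀ {ω x y} → x ≢ ω → y ≢ ω → adj ω x ≡ adj ω y → SameSubconstituent ω x y
  sameSubconstituent-off-ω x≢ω y≢ω ωx≡ωy zero             = trans (δ-≢ (x≢ω ∘ sym)) (sym (δ-≢ (y≢ω ∘ sym)))
  sameSubconstituent-off-ω x≢ω y≢ω ωx≡ωy (suc zero)       = cong b2q ωx≡ωy
  sameSubconstituent-off-ω x≢ω y≢ω ωx≡ωy (suc (suc zero)) =
    cong₂ (λ i a → (1ℚ - i) - b2q a) (trans (δ-≢ (x≢ω ∘ sym)) (sym (δ-≢ (y≢ω ∘ sym)))) ωx≡ωy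

  module _ (irreflexive : ∀ x → adj x x ≡ false) where

    A-diagonal-constant : ∀ r x y → A adj r x x ≡ A adj r y y
    A-diagonal-constant zero             x y = trans (δ-refl x) (sym (δ-refl y))
    A-diagonal-constant (suc zero)       x y = cong b2q (trans (irreflexive x) (sym (irreflexive y)))
    A-diagonal-constant (suc (suc zero)) x y =
      cong₂ (λ i a → (1ℚ - i) - b2q a) (trans (δ-refl x) (sym (δ-refl y))) (trans (irreflexive x) (sym (irreflexive y)))

    T0-diagonal-constant : ∀ {ω M} → T0 adj ω M → ∀ {x y} → SameSubconstituent ω x y → M x x ≡ M y y
    T0-diagonal-constant {ω} (gen (i , j , k , refl)) {x} {y} same = begin
      E x x                                     ≡⟨ EAE-diagonal x ⟩
      (A adj i ω x * A adj j x x) * A adj k ω x ≡⟨ cong₂ (λ a c → (a * A adj j x x) * c) (same i) (same k) ⟩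
      (A adj i ω y * A adj j x x) * A adj k ω y ≡⟨ cong (λ b → (A adj i ω y * b) * A adj k ω y) (A-diagonal-constant j x y) ⟩
      (A adj i ω y * A adj j y y) * A adj k ω y ≡⟨ EAE-diagonal y ⟨
      E y y                                     ∎
      where
      E : Mat n
      E = (Estar adj i ω *ₘ A adj j) *ₘ Estar adj k ω
      EAE-diagonal : ∀ z → E z z ≡ (A adj i ω z * A adj j z z) * A adj k ω z
      EAE-diagonal z = trans (*ₘ-diag (Estar adj i ω *ₘ A adj j) (A adj k ω) z z)
                             (cong (_* A adj k ω z) (diag-*ₘ (A adj i ω) (A adj j) z z))
    T0-diagonal-constant zer       same = refl
    T0-diagonal-constant (add p q) same = cong₂ _+_ (T0-diagonal-constant p same) (T0-diagonal-constant q same)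
    T0-diagonal-constant (scl c p) same = cong (c *_) (T0-diagonal-constant p same)
    T0-diagonal-constant (resp M≈N p) {x} {y} same = trans (sym (M≈N x x)) (trans (T0-diagonal-constant p same) (M≈N y y))

    Ttilde⊆T0⇒subconstituents⊆orbits : ∀ {ω} → (∀ M → Ttilde adj ω M → T0 adj ω M) →
                                       ∀ {x y} → SameSubconstituent ω x y → SameStabOrbit adj ω x y
    Ttilde⊆T0⇒subconstituents⊆orbits {ω} Ttilde⊆T0 {x} {y} same = b2q-does≡1 (sameStabOrbit? ω x y) (begin
      orbitIndicator ω x y ≡⟨ diag-diagonal d y ⟨
      diag d y y           ≡⟨ T0-diagonal-constant (Ttilde⊆T0 (diag d) (diag-orbitIndicator∈Ttilde ω x)) same ⟨
      diag d x x           ≡⟨ diag-diagonal d x ⟩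
      orbitIndicator ω x x ≡⟨ cong b2q (dec-true (sameStabOrbit? ω x x) sameStabOrbit-refl) ⟩
      1ℚ                   ∎)
      where
      d : Fin n → ℚ
      d = orbitIndicator ω x

    representatives⇒exactlyThree : ∀ {ω b c} → adj ω b ≡ true → c ≢ ω → adj ω c ≡ false →
                                   (∀ {x y} → SameSubconstituent ω x y → SameStabOrbit adj ω x y) →
                                   ExactlyThreeStabOrbits adj ω
    representatives⇒exactlyThree {ω} {b} {c} ωb c≢ω ωc subconstituents⊆orbits =
      ω , b , c , fixed-apart b≢ω , fixed-apart c≢ω , b≁c , cover
      where
      b≢ω : b ≢ ω
      b≢ω refl = contradiction (trans (sym ωb) (irreflexive ω)) λ ()
      fixed-apart : ∀ {x} → x ≢ ω → ¬ SameStabOrbit adj ω ω x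
      fixed-apart x≢ω (σ , (_ , σ-fix) , σω≡x) = x≢ω (trans (sym σω≡x) σ-fix)
      b≁c : ¬ SameStabOrbit adj ω b c
      b≁c (σ , (σ-aut , σ-fix) , σb≡c) with trans (sym ωb) (trans (sym (σ-aut ω b)) (trans (cong₂ adj σ-fix σb≡c) ωc))
      ... | ()
      cover : ∀ x → SameStabOrbit adj ω ω x ⊎ SameStabOrbit adj ω b x ⊎ SameStabOrbit adj ω c x
      cover x with x ≟ ω | adj ω x in ωx
      ... | yes refl | _     = inj₁ sameStabOrbit-refl
      ... | no x≢ω   | true  = inj₂ (inj₁ (subconstituents⊆orbits (sameSubconstituent-off-ω b≢ω x≢ω (trans ωb (sym ωx)))))
      ... | no x≢ω   | false = inj₂ (inj₂ (subconstituents⊆orbits (sameSubconstituent-off-ω c≢ω x≢ω (trans ωc (sym ωx)))))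

  module _ {k lam mu : ℕ} (srg : IsSRG adj k lam mu) where
    open IsSRG srg using (irreflexive; regular; nonEmpty; nonComplete)

    ∃-neighbour : ∀ ω → ∃[ b ] adj ω b ≡ true
    ∃-neighbour ω = count>0⇒∃ (adj ω) (subst (0 <_) (sym (regular ω)) nonEmpty)

    ∃-non-neighbour : ∀ ω → ∃[ c ] c ≢ ω × adj ω c ≡ false
    ∃-non-neighbour ω with Finₚ.any? (λ c → ¬? (c ≟ ω) ×-dec (adj ω c Boolₚ.≟ false))
    ... | yes found = found
    ... | no  none  =
      contradiction (subst (n ∸ 1 ≤_) (regular ω) (∸1≤count (adj ω) ω all-adjacent)) (ℕₚ.<⇒≱ nonComplete)
      where
      all-adjacent : ∀ x → x ≢ ω → adj ω x ≡ true
      all-adjacent x x≢ω = Boolₚ.¬-not (λ ωx≡false → none (x , x≢ω , ωx≡false))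

    subconstituents⊆orbits⇒exactlyThree : ∀ {ω} → (∀ {x y} → SameSubconstituent ω x y → SameStabOrbit adj ω x y) →
                                          ExactlyThreeStabOrbits adj ω
    subconstituents⊆orbits⇒exactlyThree {ω} subconstituents⊆orbits with ∃-neighbour ω | ∃-non-neighbour ω
    ... | _ , ωb | _ , c≢ω , ωc = representatives⇒exactlyThree irreflexive ωb c≢ω ωc subconstituents⊆orbits

  exactlyThreeStabOrbits-transport : ∀ {τ ω ω′} → IsAut adj τ → τ ⟨$⟩ʳ ω ≡ ω′ →
                                     ExactlyThreeStabOrbits adj ω → ExactlyThreeStabOrbits adj ω′
  exactlyThreeStabOrbits-transport {τ} {ω} {ω′} τ-aut τω≡ω′ (a , b , c , a≁b , a≁c , b≁c , cover) =
    τ ⟨$⟩ʳ a , τ ⟨$⟩ʳ b , τ ⟨$⟩ʳ c , a≁b ∘ pull , a≁c ∘ pull , b≁c ∘ pull ,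
    λ x → Sum.map push (Sum.map push push) (cover (τ ⟨$⟩ˡ x))
    where
    pull : ∀ {x y} → SameStabOrbit adj ω′ (τ ⟨$⟩ʳ x) (τ ⟨$⟩ʳ y) → SameStabOrbit adj ω x y
    pull = sameStabOrbit-transport {flip τ} (IsAut-flip {τ} τ-aut)
             (trans (cong (τ ⟨$⟩ˡ_) (sym τω≡ω′)) (inverseˡ τ)) (inverseˡ τ) (inverseˡ τ)
    push : ∀ {x y} → SameStabOrbit adj ω x (τ ⟨$⟩ˡ y) → SameStabOrbit adj ω′ (τ ⟨$⟩ʳ x) y
    push = sameStabOrbit-transport {τ} τ-aut τω≡ω′ refl (inverseʳ τ)

corollary5p2 : ∀ (n : ℕ) (adj : Graph n) → StronglyRegular adj → TriplyTransitive adj → Rank3Graph adj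
corollary5p2 n adj (_ , _ , _ , srg) (transitive , ω₀ , T0⇔T , T⇔Ttilde) = transitive , exactlyThree
  where
  Ttilde⊆T0 : ∀ M → Ttilde adj ω₀ M → T0 adj ω₀ M
  Ttilde⊆T0 M = Equivalence.from (T0⇔T M) ∘ Equivalence.from (T⇔Ttilde M)

  exactlyThree₀ : ExactlyThreeStabOrbits adj ω₀
  exactlyThree₀ = subconstituents⊆orbits⇒exactlyThree adj srg
                    (Ttilde⊆T0⇒subconstituents⊆orbits adj (IsSRG.irreflexive srg) Ttilde⊆T0)

  exactlyThree : ∀ ω → ExactlyThreeStabOrbits adj ω
  exactlyThree ω with transitive ω₀ ω
  ... | τ , τ-aut , τω₀≡ω = exactlyThreeStabOrbits-transport adj {τ} τ-aut τω₀≡ω exactlyThree₀
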